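{- Let $\Gamma \vdash_G \Delta$ be a labelled sequent and let $z, x \in \mathrm{nodes}(G)$. If the nested sequent $\langle \Gamma\vdash_G\Delta\rangle_z$ is derivable in $\mathbf{N}\text{ - }\mathbf{LBiI}$, then so is $\langle \Gamma\vdash_G\Delta\rangle_x$.
   Context: Formulas: $A,B ::= p \mid \top \mid \bot \mid A\wedge B \mid A \vee B \mid A \supset B \mid A \mathbin{ -\!\!<} B$ ($p$ propositional variables; $\mathbin{ -\!\!<}$ is exclusion). Labelled sequents: a label tree $G$ is a finite directed graph with nonempty node set $\mathrm{nodes}(G)$ (labels) such that any two nodes are connected by exactly one path along forward and backward arcs; write $xGy$ if there is an arc from $x$ to $y$. A labelled sequent $\Gamma\vdash_G\Delta$ consists of a label tree $G$ and finite multisets $\Gamma,\Delta$ of labelled formulas $x:A$ with $x\in\mathrm{nodes}(G)$. Nested sequents: $S ::= \Gamma\vdash\Delta$, where nested contexts $\Gamma,\Delta ::= \emptyset\mid A,\Gamma\mid S,\Gamma$ are finite multisets of formulas and nested sequents. Translation $\langle\Gamma\vdash_G\Delta\rangle_x$ for $x\in\mathrm{nodes}(G)$: for each arc of $G$ incident to $x$ with other endpoint $y$, let $G_y$ be the connected component containing $y$ of the graph obtained from $G$ by removing that arc, and let $\Gamma[G_y],\Delta[G_y]$ be the labelled formulas of $\Gamma,\Delta$ whose labels lie in $G_y$. Then $\langle\Gamma\vdash_G\Delta\rangle_x$ is the nested sequent whose antecedent consists of all $A$ with $x:A\in\Gamma$ together with the nested sequents $\langle\Gamma[G_y]\vdash_{G_y}\Delta[G_y]\rangle_y$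 for each $y$ with $yGx$, and whose succedent consists of all $A$ with $x:A\in\Delta$ together with the nested sequents $\langle\Gamma[G_y]\vdash_{G_y}\Delta[G_y]\rangle_y$ for each $y$ with $xGy$ (recursively). The calculus $\mathbf{N}\text{ - }\mathbf{LBiI}$ (rules: premises $\Rightarrow$ conclusion; $\Gamma,\Delta,\Gamma_0,\Delta_0$ nested contexts, $A,B$ formulas): hyp: $\Gamma,A\vdash A,\Delta$; cut: $\Gamma\vdash A,\Delta$ and $\Gamma,A\vdash\Delta\Rightarrow\Gamma\vdash\Delta$; weakL/R: $\Gamma\vdash\Delta\Rightarrow\Gamma,A\vdash\Delta$ / $\Gamma\vdash A,\Delta$; contrL/R: $\Gamma,A,A\vdash\Delta\Rightarrow\Gamma,A\vdash\Delta$ / $\Gamma\vdash A,A,\Delta\Rightarrow\Gamma\vdash A,\Delta$; $\top$L: $\Gamma\vdash\Delta\Rightarrow\Gamma,\top\vdash\Delta$; $\top$R: $\Gamma\vdash\top,\Delta$; $\bot$L: $\Gamma,\bot\vdash\Delta$; $\bot$R: $\Gamma\vdash\Delta\Rightarrow\Gamma\vdash\bot,\Delta$; $\wedge$L: $\Gamma,A,B\vdash\Delta\Rightarrow\Gamma,A\wedge B\vdash\Delta$; $\wedge$R: $\Gamma\vdash A,\Delta$ and $\Gamma\vdash B,\Delta\Rightarrow\Gamma\vdash A\wedge B,\Delta$; $\vee$L: $\Gamma,A\vdash\Delta$ and $\Gamma,B\vdash\Delta\Rightarrow\Gamma,A\vee B\vdash\Delta$; $\vee$R: $\Gamma\vdash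 A,B,\Delta\Rightarrow\Gamma\vdash A\vee B,\Delta$; $\supset$L: $\Gamma,A\supset B\vdash A,\Delta$ and $\Gamma,B\vdash\Delta\Rightarrow\Gamma,A\supset B\vdash\Delta$; $\supset$R: $\Gamma,A\vdash B\Rightarrow\Gamma\vdash A\supset B,\Delta$; $\mathbin{ -\!\!<}$L: $A\vdash B,\Delta\Rightarrow\Gamma,A\mathbin{ -\!\!<}B\vdash\Delta$; $\mathbin{ -\!\!<}$R: $\Gamma\vdash A,\Delta$ and $\Gamma,B\vdash A\mathbin{ -\!\!<}B,\Delta\Rightarrow\Gamma\vdash A\mathbin{ -\!\!<}B,\Delta$; nestL: $\Gamma_0\vdash\Delta_0,\Delta\Rightarrow\Gamma,(\Gamma_0\vdash\Delta_0)\vdash\Delta$; nestR: $\Gamma,\Gamma_0\vdash\Delta_0\Rightarrow\Gamma\vdash(\Gamma_0\vdash\Delta_0),\Delta$; unnestL: $\Gamma,(\Gamma_0\vdash\Delta_0)\vdash\Delta\Rightarrow\Gamma,\Gamma_0\vdash\Delta_0,\Delta$; unnestR: $\Gamma\vdash(\Gamma_0\vdash\Delta_0),\Delta\Rightarrow\Gamma,\Gamma_0\vdash\Delta_0,\Delta$. -}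

module Defs where

open import Data.Nat using (ℕ; zero; suc; _≟_)
open import Data.Product using (Σ; _×_; _,_; proj₁; proj₂)
open import Data.Product.Properties using (≡-dec)
open import Data.List using (List; []; _∷_; _++_; [_]; map; filter; concatMap; length)
open import Data.List.Membership.Propositional using (_∈_; _∉_)
open import Data.List.Membership.DecPropositional _≟_ using (_∈?_)
open import Data.List.Relation.Unary.Unique.Propositional using (Unique)
open import Relation.Binary.PropositionalEquality using (_≡_; _≢_)
open import Relation.Nullary using (¬_; yes; no)
open import Relation.Nullary.Decidable using (¬?; _×-dec_)
open import Relation.Binary using (DecidableEquality)

infixr 6 _∧_
infixr 5 _∨_
infixr 4 _⊃_ _-<_

data Fm : Set where
  var  : ℕ → Fm
  ⊤ ⊥  : Fm
  _∧_ _∨_ _⊃_ _-<_ : Fm → Fm → Fm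

-- Nested sequents.  Nested contexts are finite multisets of formulas and
-- nested sequents; we represent them by lists and identify them up to
-- (recursive) multiset equality _≈ₛ_ below.

infix 3 _⊢_

mutual
  data Item : Set where
    fm : Fm → Item
    sq : Seq → Item

  data Seq : Set where
    _⊢_ : List Item → List Item → Seq

Ctx : Set
Ctx = List Item

infix 4 _≈ᵢ_ _≋_ _≈ₛ_

mutual
  data _≈ᵢ_ : Item → Item → Set where
    fm≈ : ∀ {A} → fm A ≈ᵢ fm A
    sq≈ : ∀ {S T} → S ≈ₛ T → sq S ≈ᵢ sq T

  data _≈ₛ_ : Seq → Seq → Set where
    ⊢≈ : ∀ {Γ Γ' Δ Δ'} → Γ ≋ Γ' → Δ ≋ Δ' → (Γ ⊢ Δ) ≈ₛ (Γ' ⊢ Δ')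

  data _≋_ : Ctx → Ctx → Set where
    []≋   : [] ≋ []
    prep≋ : ∀ {i j Γ Δ} → i ≈ᵢ j → Γ ≋ Δ → (i ∷ Γ) ≋ (j ∷ Δ)
    swap≋ : ∀ {i i' j j' Γ Δ} → i ≈ᵢ i' → j ≈ᵢ j' → Γ ≋ Δ →
            (i ∷ j ∷ Γ) ≋ (j' ∷ i' ∷ Δ)
    trans≋ : ∀ {Γ Δ Θ} → Γ ≋ Δ → Δ ≋ Θ → Γ ≋ Θ

-- The calculus N-LBiI.  "Γ , A" is written  fm A ∷ Γ ,  "Γ , Γ₀" is
-- written  Γ ++ Γ₀ ; since contexts are multisets, derivability is closed
-- under multiset equality (rule  perm ).

data N-LBiI : Seq → Set where
  perm : ∀ {S T} → S ≈ₛ T → N-LBiI S → N-LBiI T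
  hyp  : ∀ {Γ Δ A} → N-LBiI (fm A ∷ Γ ⊢ fm A ∷ Δ)
  cut  : ∀ {Γ Δ A} → N-LBiI (Γ ⊢ fm A ∷ Δ) → N-LBiI (fm A ∷ Γ ⊢ Δ) → N-LBiI (Γ ⊢ Δ)
  weakL : ∀ {Γ Δ A} → N-LBiI (Γ ⊢ Δ) → N-LBiI (fm A ∷ Γ ⊢ Δ)
  weakR : ∀ {Γ Δ A} → N-LBiI (Γ ⊢ Δ) → N-LBiI (Γ ⊢ fm A ∷ Δ)
  contrL : ∀ {Γ Δ A} → N-LBiI (fm A ∷ fm A ∷ Γ ⊢ Δ) → N-LBiI (fm A ∷ Γ ⊢ Δ)
  contrR : ∀ {Γ Δ A} → N-LBiI (Γ ⊢ fm A ∷ fm A ∷ Δ) → N-LBiI (Γ ⊢ fm A ∷ Δ)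
  ⊤L : ∀ {Γ Δ} → N-LBiI (Γ ⊢ Δ) → N-LBiI (fm ⊤ ∷ Γ ⊢ Δ)
  ⊤R : ∀ {Γ Δ} → N-LBiI (Γ ⊢ fm ⊤ ∷ Δ)
  ⊥L : ∀ {Γ Δ} → N-LBiI (fm ⊥ ∷ Γ ⊢ Δ)
  ⊥R : ∀ {Γ Δ} → N-LBiI (Γ ⊢ Δ) → N-LBiI (Γ ⊢ fm ⊥ ∷ Δ)
  ∧L : ∀ {Γ Δ A B} → N-LBiI (fm A ∷ fm B ∷ Γ ⊢ Δ) → N-LBiI (fm (A ∧ B) ∷ Γ ⊢ Δ)
  ∧R : ∀ {Γ Δ A B} → N-LBiI (Γ ⊢ fm A ∷ Δ) → N-LBiI (Γ ⊢ fm B ∷ Δ) →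
       N-LBiI (Γ ⊢ fm (A ∧ B) ∷ Δ)
  ∨L : ∀ {Γ Δ A B} → N-LBiI (fm A ∷ Γ ⊢ Δ) → N-LBiI (fm B ∷ Γ ⊢ Δ) →
       N-LBiI (fm (A ∨ B) ∷ Γ ⊢ Δ)
  ∨R : ∀ {Γ Δ A B} → N-LBiI (Γ ⊢ fm A ∷ fm B ∷ Δ) → N-LBiI (Γ ⊢ fm (A ∨ B) ∷ Δ)
  ⊃L : ∀ {Γ Δ A B} → N-LBiI (fm (A ⊃ B) ∷ Γ ⊢ fm A ∷ Δ) → N-LBiI (fm B ∷ Γ ⊢ Δ) →
       N-LBiI (fm (A ⊃ B) ∷ Γ ⊢ Δ)
  ⊃R : ∀ {Γ Δ A B} → N-LBiI (fm A ∷ Γ ⊢ fm B ∷ []) → N-LBiI (Γ ⊢ fm (A ⊃ B) ∷ Δ)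
  -<L : ∀ {Γ Δ A B} → N-LBiI (fm A ∷ [] ⊢ fm B ∷ Δ) → N-LBiI (fm (A -< B) ∷ Γ ⊢ Δ)
  -<R : ∀ {Γ Δ A B} → N-LBiI (Γ ⊢ fm A ∷ Δ) → N-LBiI (fm B ∷ Γ ⊢ fm (A -< B) ∷ Δ) →
        N-LBiI (Γ ⊢ fm (A -< B) ∷ Δ)
  nestL : ∀ {Γ Δ Γ₀ Δ₀} → N-LBiI (Γ₀ ⊢ Δ₀ ++ Δ) → N-LBiI (sq (Γ₀ ⊢ Δ₀) ∷ Γ ⊢ Δ)
  nestR : ∀ {Γ Δ Γ₀ Δ₀} → N-LBiI (Γ ++ Γ₀ ⊢ Δ₀) → N-LBiI (Γ ⊢ sq (Γ₀ ⊢ Δ₀) ∷ Δ)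
  unnestL : ∀ {Γ Δ Γ₀ Δ₀} → N-LBiI (sq (Γ₀ ⊢ Δ₀) ∷ Γ ⊢ Δ) → N-LBiI (Γ ++ Γ₀ ⊢ Δ₀ ++ Δ)
  unnestR : ∀ {Γ Δ Γ₀ Δ₀} → N-LBiI (Γ ⊢ sq (Γ₀ ⊢ Δ₀) ∷ Δ) → N-LBiI (Γ ++ Γ₀ ⊢ Δ₀ ++ Δ)

-- Label trees.  Labels are natural numbers; a finite directed graph is a
-- duplicate-free list of nodes and a duplicate-free list of arcs (x , y)
-- meaning  x G y .

Arc : Set
Arc = ℕ × ℕ

data Dir : Set where
  fwd bwd : Dir

-- Walk arcs x ws y : following the steps ws (each going along an arc
-- forwards or backwards, to the indicated node) leads from x to y.
data Walk (arcs : List Arc) : ℕ → List (Dir × ℕ) → ℕ → Set where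
  stop : ∀ {x} → Walk arcs x [] x
  fwd∷ : ∀ {x z ws y} → (x , z) ∈ arcs → Walk arcs z ws y → Walk arcs x ((fwd , z) ∷ ws) y
  bwd∷ : ∀ {x z ws y} → (z , x) ∈ arcs → Walk arcs z ws y → Walk arcs x ((bwd , z) ∷ ws) y

IsPath : List Arc → ℕ → List (Dir × ℕ) → ℕ → Set
IsPath arcs x ws y = Walk arcs x ws y × Unique (x ∷ map proj₂ ws)

record LabelTree : Set where
  field
    nodes      : List ℕ
    arcs       : List Arc
    nonempty   : nodes ≢ []
    nodes-uniq : Unique nodes
    arcs-uniq  : Unique arcs
    arcs-src   : ∀ {x y} → (x , y) ∈ arcs → x ∈ nodes
    arcs-tgt   : ∀ {x y} → (x , y) ∈ arcs → y ∈ nodes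
    no-loops   : ∀ {x} → (x , x) ∉ arcs
    unique-path : ∀ x y → x ∈ nodes → y ∈ nodes →
                  Σ (List (Dir × ℕ)) λ ws → IsPath arcs x ws y ×
                    (∀ ws' → IsPath arcs x ws' y → ws' ≡ ws)

open LabelTree public

-- Labelled sequents  Γ ⊢_G Δ : a label tree with multisets (lists) of
-- labelled formulas whose labels are nodes of G.

LFms : Set
LFms = List (ℕ × Fm)

LabelsIn : LabelTree → LFms → Set
LabelsIn G Γ = ∀ {x A} → (x , A) ∈ Γ → x ∈ nodes G

_≟ₐ_ : DecidableEquality Arc
_≟ₐ_ = ≡-dec _≟_ _≟_

reachStep : List Arc → List ℕ → List ℕ
reachStep as S = S ++ concatMap (λ { (a , b) → from a b ++ from b a }) as
  where
  from : ℕ → ℕ → List ℕ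
  from a b with a ∈? S
  ... | yes _ = [ b ]
  ... | no  _ = []

reach : ℕ → List Arc → List ℕ → List ℕ
reach zero    as S = S
reach (suc n) as S = reach n as (reachStep as S)

component : List ℕ → List Arc → ℕ → List ℕ
component N as y = filter (_∈? reach (length N) as [ y ]) N

restrict : List ℕ → LFms → LFms
restrict C Γ = filter (λ p → proj₁ p ∈? C) Γ

at : ℕ → LFms → List Item
at x Γ = map (λ p → fm (proj₂ p)) (filter (λ p → proj₁ p ≟ x) Γ)

transl : ℕ → List ℕ → List Arc → LFms → LFms → ℕ → Seq
transl zero    N as Γ Δ x = [] ⊢ []
transl (suc n) N as Γ Δ x =
  (at x Γ ++ concatMap inAnt as) ⊢ (at x Δ ++ concatMap inSuc as)
  where
  -- ⟨Γ[G_y] ⊢_{G_y} Δ[G_y]⟩_y where G_y is the component of y after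
  -- removing the arc a
  sub : Arc → ℕ → Item
  sub a y = sq (transl n Cy asy (restrict Cy Γ) (restrict Cy Δ) y)
    where
    as' : List Arc
    as' = filter (λ b → ¬? (b ≟ₐ a)) as
    Cy : List ℕ
    Cy = component N as' y
    asy : List Arc
    asy = filter (λ b → (proj₁ b ∈? Cy) ×-dec (proj₂ b ∈? Cy)) as'
  inAnt : Arc → List Item
  inAnt (y , x') with x' ≟ x
  ... | yes _ = [ sub (y , x') y ]
  ... | no  _ = []
  inSuc : Arc → List Item
  inSuc (x' , y) with x' ≟ x
  ... | yes _ = [ sub (x' , y) y ]
  ... | no  _ = []

-- ⟨Γ ⊢_G Δ⟩_x  (fuel = 1 + number of nodes, which exceeds the depth of
-- any label tree, so the fuel never runs out on label trees)
⟨_⊢[_]_⟩_ : LFms → LabelTree → LFms → ℕ → Seq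
⟨ Γ ⊢[ G ] Δ ⟩ x = transl (suc (length (nodes G))) (nodes G) (arcs G) Γ Δ x

module Submission where

-- Each arc (u , v) of G occurs twice: the translation at u has the nested sequent of the
-- v-side of G in its succedent, the translation at v has the nested sequent of the u-side
-- in its antecedent, and what remains at u (at v) is exactly the u-side (v-side) sequent.
-- Up to exchange the two translations are therefore  P ⊢ (P' ⊢ Q'), Q  and
-- (P ⊢ Q), P' ⊢ Q' .  Under the formula interpretation of nested sequents (implication in
-- the succedent, exclusion in the antecedent), which is sound and complete for N-LBiI,
-- both amount to  ⋀ P ⇛ (⋀ P' ⊃ ⋁ Q') ∨ ⋁ Q , so they are interderivable.  The theorem
-- follows by moving the root from z to x one arc at a time.

open import Defs
open import Data.Nat using (ℕ; zero; suc; _≟_; _≤_; _<_; s≤s; z≤n)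
open import Data.Nat.Properties using (≤-trans; ≤-refl; n≤1+n; ≤-pred; <-≤-trans; <-trans)
open import Data.List using (List; []; _∷_; _++_; [_]; map; length; filter; concatMap)
open import Data.List.Properties using (length-map; filter-all; filter-notAll)
open import Data.List.Membership.Propositional using (_∈_; _∉_; find)
open import Data.List.Membership.Propositional.Properties
  using (∈-∃++; ∈-++⁻; ∈-++⁺ˡ; ∈-++⁺ʳ; ∈-concatMap⁻; ∈-concatMap⁺; ∈-filter⁻; ∈-filter⁺)
open import Data.List.Membership.DecPropositional _≟_ using (_∈?_)
open import Data.List.Relation.Unary.Any using (Any; here; there)
import Data.List.Relation.Unary.Any as Any
import Data.List.Relation.Unary.All as All
open import Data.List.Relation.Unary.All using ([]; _∷_)
open import Data.List.Relation.Unary.All.Properties using (¬Any⇒All¬)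
open import Data.List.Relation.Unary.AllPairs using ([]; _∷_)
open import Data.List.Relation.Unary.Unique.Propositional using (Unique)
open import Data.List.Relation.Binary.Permutation.Propositional as ↭ using (_↭_; ↭-sym; ↭-reflexive)
import Data.List.Relation.Binary.Permutation.Propositional.Properties as ↭
open import Data.Product using (Σ; _×_; _,_; proj₁; proj₂)
open import Data.Sum using (_⊎_; inj₁; inj₂; [_,_]′)
open import Data.Empty using (⊥-elim)
open import Relation.Nullary using (¬_; yes; no; Dec)
open import Relation.Nullary.Decidable using (¬?; _×-dec_)
open import Relation.Unary using (Decidable)
open import Relation.Binary using (DecidableEquality)
open import Relation.Binary.PropositionalEquality
  using (_≡_; _≢_; refl; sym; trans; cong; cong₂; subst)

mutual
  ≈ᵢ-refl : ∀ i → i ≈ᵢ i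
  ≈ᵢ-refl (fm A) = fm≈
  ≈ᵢ-refl (sq S) = sq≈ (≈ₛ-refl S)

  ≈ₛ-refl : ∀ S → S ≈ₛ S
  ≈ₛ-refl (Γ ⊢ Δ) = ⊢≈ (≋-refl Γ) (≋-refl Δ)

  ≋-refl : ∀ Γ → Γ ≋ Γ
  ≋-refl []      = []≋
  ≋-refl (i ∷ Γ) = prep≋ (≈ᵢ-refl i) (≋-refl Γ)

↭⇒≋ : ∀ {Γ Δ} → Γ ↭ Δ → Γ ≋ Δ
↭⇒≋ ↭.refl         = ≋-refl _
↭⇒≋ (↭.prep i p)   = prep≋ (≈ᵢ-refl i) (↭⇒≋ p)
↭⇒≋ (↭.swap i j p) = swap≋ (≈ᵢ-refl i) (≈ᵢ-refl j) (↭⇒≋ p)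
↭⇒≋ (↭.trans p q)  = trans≋ (↭⇒≋ p) (↭⇒≋ q)

≋-++ʳ : ∀ {Γ Δ} Θ → Γ ≋ Δ → Γ ++ Θ ≋ Δ ++ Θ
≋-++ʳ Θ []≋           = ≋-refl Θ
≋-++ʳ Θ (prep≋ i p)   = prep≋ i (≋-++ʳ Θ p)
≋-++ʳ Θ (swap≋ i j p) = swap≋ i j (≋-++ʳ Θ p)
≋-++ʳ Θ (trans≋ p q)  = trans≋ (≋-++ʳ Θ p) (≋-++ʳ Θ q)

exchange : ∀ {Γ Γ' Δ Δ'} → Γ ↭ Γ' → Δ ↭ Δ' → N-LBiI (Γ ⊢ Δ) → N-LBiI (Γ' ⊢ Δ')
exchange p q = perm (⊢≈ (↭⇒≋ p) (↭⇒≋ q))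

exchangeˡ : ∀ {Γ Γ' Δ} → Γ ↭ Γ' → N-LBiI (Γ ⊢ Δ) → N-LBiI (Γ' ⊢ Δ)
exchangeˡ p = exchange p ↭.refl

exchangeʳ : ∀ {Γ Δ Δ'} → Δ ↭ Δ' → N-LBiI (Γ ⊢ Δ) → N-LBiI (Γ ⊢ Δ')
exchangeʳ = exchange ↭.refl

swapˡ : ∀ {i j Γ Δ} → N-LBiI (i ∷ j ∷ Γ ⊢ Δ) → N-LBiI (j ∷ i ∷ Γ ⊢ Δ)
swapˡ = exchangeˡ (↭.swap _ _ ↭.refl)

swapʳ : ∀ {i j Γ Δ} → N-LBiI (Γ ⊢ i ∷ j ∷ Δ) → N-LBiI (Γ ⊢ j ∷ i ∷ Δ)
swapʳ = exchangeʳ (↭.swap _ _ ↭.refl)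

hyp-∈ : ∀ {Γ Δ A} → fm A ∈ Γ → fm A ∈ Δ → N-LBiI (Γ ⊢ Δ)
hyp-∈ A∈Γ A∈Δ with ∈-∃++ A∈Γ | ∈-∃++ A∈Δ
... | Γ₁ , Γ₂ , refl | Δ₁ , Δ₂ , refl =
  exchange (↭-sym (↭.shift _ Γ₁ Γ₂)) (↭-sym (↭.shift _ Δ₁ Δ₂)) hyp

↭-swap-last : ∀ {A : Set} (xs ys zs : List A) → (xs ++ ys) ++ zs ↭ (xs ++ zs) ++ ys
↭-swap-last xs ys zs =
  ↭.trans (↭.++-assoc xs ys zs)
    (↭.trans (↭.++⁺ˡ xs (↭.++-comm ys zs)) (↭-sym (↭.++-assoc xs zs ys)))

-- The rules ⊃R, -<L, nestL, nestR discard a side context, so only one side is weakened there.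
weaken : ∀ {Γ Δ} X Y → N-LBiI (Γ ⊢ Δ) → N-LBiI (Γ ++ X ⊢ Δ ++ Y)
weaken X Y (perm (⊢≈ p q) d) = perm (⊢≈ (≋-++ʳ X p) (≋-++ʳ Y q)) (weaken X Y d)
weaken X Y hyp        = hyp
weaken X Y (cut d e)  = cut (weaken X Y d) (weaken X Y e)
weaken X Y (weakL d)  = weakL (weaken X Y d)
weaken X Y (weakR d)  = weakR (weaken X Y d)
weaken X Y (contrL d) = contrL (weaken X Y d)
weaken X Y (contrR d) = contrR (weaken X Y d)
weaken X Y (⊤L d)     = ⊤L (weaken X Y d)
weaken X Y ⊤R         = ⊤R
weaken X Y ⊥L         = ⊥L
weaken X Y (⊥R d)     = ⊥R (weaken X Y d)
weaken X Y (∧L d)     = ∧L (weaken X Y d)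
weaken X Y (∧R d e)   = ∧R (weaken X Y d) (weaken X Y e)
weaken X Y (∨L d e)   = ∨L (weaken X Y d) (weaken X Y e)
weaken X Y (∨R d)     = ∨R (weaken X Y d)
weaken X Y (⊃L d e)   = ⊃L (weaken X Y d) (weaken X Y e)
weaken X Y (⊃R d)     = ⊃R (weaken X [] d)
weaken X Y (-<L d)    = -<L (weaken [] Y d)
weaken X Y (-<R d e)  = -<R (weaken X Y d) (weaken X Y e)
weaken X Y (nestL {Δ = Δ} {Δ₀ = Δ₀} d) =
  nestL (exchange (↭.++-identityʳ _) (↭.++-assoc Δ₀ Δ Y) (weaken [] Y d))
weaken X Y (nestR {Γ = Γ} {Γ₀ = Γ₀} d) =
  nestR (exchange (↭-swap-last Γ Γ₀ X) (↭.++-identityʳ _) (weaken X [] d))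
weaken X Y (unnestL {Γ = Γ} {Δ} {Γ₀} {Δ₀} d) =
  exchange (↭-swap-last Γ X Γ₀) (↭-sym (↭.++-assoc Δ₀ Δ Y)) (unnestL (weaken X Y d))
weaken X Y (unnestR {Γ = Γ} {Δ} {Γ₀} {Δ₀} d) =
  exchange (↭-swap-last Γ X Γ₀) (↭-sym (↭.++-assoc Δ₀ Δ Y)) (unnestR (weaken X Y d))

-- The formula interpretation of nested sequents

mutual
  ⟦_⟧ᴸ : Item → Fm
  ⟦ fm A ⟧ᴸ       = A
  ⟦ sq (Γ ⊢ Δ) ⟧ᴸ = ⋀ Γ -< ⋁ Δ

  ⟦_⟧ᴿ : Item → Fm
  ⟦ fm A ⟧ᴿ       = A
  ⟦ sq (Γ ⊢ Δ) ⟧ᴿ = ⋀ Γ ⊃ ⋁ Δ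

  ⋀ : Ctx → Fm
  ⋀ []      = ⊤
  ⋀ (i ∷ Γ) = ⟦ i ⟧ᴸ ∧ ⋀ Γ

  ⋁ : Ctx → Fm
  ⋁ []      = ⊥
  ⋁ (i ∷ Δ) = ⟦ i ⟧ᴿ ∨ ⋁ Δ

infix 2 _⇛_ _⇔_
infixr 9 _⨾_
infixr 7 _⟨∧⟩_
infixr 6 _⟨∨⟩_

_⇛_ : Fm → Fm → Set
A ⇛ B = N-LBiI (fm A ∷ [] ⊢ fm B ∷ [])

_⇔_ : Fm → Fm → Set
A ⇔ B = (A ⇛ B) × (B ⇛ A)

_⨾_ : ∀ {A B C} → A ⇛ B → B ⇛ C → A ⇛ C
p ⨾ q = cut (swapʳ (weakR p)) (swapˡ (weakL q))

∧E₁ : ∀ {A B} → A ∧ B ⇛ A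
∧E₁ = ∧L hyp

∧E₂ : ∀ {A B} → A ∧ B ⇛ B
∧E₂ = ∧L (swapˡ hyp)

∨I₁ : ∀ {A B} → A ⇛ A ∨ B
∨I₁ = ∨R hyp

∨I₂ : ∀ {A B} → B ⇛ A ∨ B
∨I₂ = ∨R (swapʳ hyp)

⊃I : ∀ {A B C} → A ∧ B ⇛ C → A ⇛ B ⊃ C
⊃I p = ⊃R (cut (∧R (hyp-∈ (there (here refl)) (here refl)) (hyp-∈ (here refl) (here refl)))
                (weaken (_ ∷ _ ∷ []) [] p))

⊃E : ∀ {A B} → (A ⊃ B) ∧ A ⇛ B
⊃E = ∧L (⊃L (hyp-∈ (there (here refl)) (here refl)) hyp)

-<I : ∀ {A B C} → A ⇛ B ∨ C → A -< B ⇛ C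
-<I p = -<L (cut (weaken [] (_ ∷ _ ∷ []) p)
                 (∨L (hyp-∈ (here refl) (here refl)) (hyp-∈ (here refl) (there (here refl)))))

-<E : ∀ {A B} → A ⇛ B ∨ (A -< B)
-<E = ∨R (swapʳ (-<R hyp (hyp-∈ (here refl) (there (here refl)))))

∧-distribˡ-∨ : ∀ {A B C} → A ∧ (B ∨ C) ⇛ (A ∧ B) ∨ (A ∧ C)
∧-distribˡ-∨ = ∧L (swapˡ (∨L
  (∨R (∧R (hyp-∈ (there (here refl)) (here refl)) hyp))
  (∨R (swapʳ (∧R (hyp-∈ (there (here refl)) (here refl)) hyp)))))

_⟨∧⟩_ : ∀ {A B C D} → A ⇛ B → C ⇛ D → A ∧ C ⇛ B ∧ D
p ⟨∧⟩ q = ∧R (∧E₁ ⨾ p) (∧E₂ ⨾ q)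

_⟨∨⟩_ : ∀ {A B C D} → A ⇛ B → C ⇛ D → A ∨ C ⇛ B ∨ D
p ⟨∨⟩ q = ∨L (p ⨾ ∨I₁) (q ⨾ ∨I₂)

∧-comm : ∀ {A B} → A ∧ B ⇛ B ∧ A
∧-comm = ∧R ∧E₂ ∧E₁

∨-comm : ∀ {A B} → A ∨ B ⇛ B ∨ A
∨-comm = ∨L ∨I₂ ∨I₁

∧-assocˡ : ∀ {A B C} → (A ∧ B) ∧ C ⇛ A ∧ (B ∧ C)
∧-assocˡ = ∧R (∧E₁ ⨾ ∧E₁) (∧R (∧E₁ ⨾ ∧E₂) ∧E₂)

∧-assocʳ : ∀ {A B C} → A ∧ (B ∧ C) ⇛ (A ∧ B) ∧ C
∧-assocʳ = ∧R (∧R ∧E₁ (∧E₂ ⨾ ∧E₁)) (∧E₂ ⨾ ∧E₂)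

∨-assocˡ : ∀ {A B C} → (A ∨ B) ∨ C ⇛ A ∨ (B ∨ C)
∨-assocˡ = ∨L (∨L ∨I₁ (∨I₁ ⨾ ∨I₂)) (∨I₂ ⨾ ∨I₂)

∨-assocʳ : ∀ {A B C} → A ∨ (B ∨ C) ⇛ (A ∨ B) ∨ C
∨-assocʳ = ∨L (∨I₁ ⨾ ∨I₁) (∨L (∨I₂ ⨾ ∨I₁) ∨I₂)

∧-distribʳ-∨ : ∀ {A B C} → (B ∨ C) ∧ A ⇛ (B ∧ A) ∨ (C ∧ A)
∧-distribʳ-∨ = ∧-comm ⨾ ∧-distribˡ-∨ ⨾ (∧-comm ⟨∨⟩ ∧-comm)

cut-⇛ : ∀ {G A D} → G ⇛ A ∨ D → A ∧ G ⇛ D → G ⇛ D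
cut-⇛ p q = ∧R hyp p ⨾ ∧-distribˡ-∨ ⨾ ∨L (∧-comm ⨾ q) ∧E₂

⊃-mono : ∀ {A A' B B'} → A' ⇛ A → B ⇛ B' → A ⊃ B ⇛ A' ⊃ B'
⊃-mono p q = ⊃I ((hyp ⟨∧⟩ p) ⨾ ⊃E ⨾ q)

-<-mono : ∀ {A A' B B'} → A ⇛ A' → B' ⇛ B → A -< B ⇛ A' -< B'
-<-mono p q = -<I (p ⨾ -<E ⨾ (q ⟨∨⟩ hyp))

mutual
  ⟦⟧ᴸ-cong : ∀ {i j} → i ≈ᵢ j → ⟦ i ⟧ᴸ ⇔ ⟦ j ⟧ᴸ
  ⟦⟧ᴸ-cong fm≈ = hyp , hyp
  ⟦⟧ᴸ-cong (sq≈ (⊢≈ p q)) with ⋀-cong p | ⋁-cong q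
  ... | a , a' | b , b' = -<-mono a b' , -<-mono a' b

  ⟦⟧ᴿ-cong : ∀ {i j} → i ≈ᵢ j → ⟦ i ⟧ᴿ ⇔ ⟦ j ⟧ᴿ
  ⟦⟧ᴿ-cong fm≈ = hyp , hyp
  ⟦⟧ᴿ-cong (sq≈ (⊢≈ p q)) with ⋀-cong p | ⋁-cong q
  ... | a , a' | b , b' = ⊃-mono a' b , ⊃-mono a b'

  ⋀-cong : ∀ {Γ Δ} → Γ ≋ Δ → ⋀ Γ ⇔ ⋀ Δ
  ⋀-cong []≋ = hyp , hyp
  ⋀-cong (prep≋ i p) with ⟦⟧ᴸ-cong i | ⋀-cong p
  ... | a , a' | b , b' = a ⟨∧⟩ b , a' ⟨∧⟩ b'
  ⋀-cong (swap≋ i j p) with ⟦⟧ᴸ-cong i | ⟦⟧ᴸ-cong j | ⋀-cong p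
  ... | a , a' | b , b' | c , c' =
    ∧R (∧E₂ ⨾ ∧E₁ ⨾ b) (∧R (∧E₁ ⨾ a) (∧E₂ ⨾ ∧E₂ ⨾ c)) ,
    ∧R (∧E₂ ⨾ ∧E₁ ⨾ a') (∧R (∧E₁ ⨾ b') (∧E₂ ⨾ ∧E₂ ⨾ c'))
  ⋀-cong (trans≋ p q) with ⋀-cong p | ⋀-cong q
  ... | a , a' | b , b' = a ⨾ b , b' ⨾ a'

  ⋁-cong : ∀ {Γ Δ} → Γ ≋ Δ → ⋁ Γ ⇔ ⋁ Δ
  ⋁-cong []≋ = hyp , hyp
  ⋁-cong (prep≋ i p) with ⟦⟧ᴿ-cong i | ⋁-cong p
  ... | a , a' | b , b' = a ⟨∨⟩ b , a' ⟨∨⟩ b'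
  ⋁-cong (swap≋ i j p) with ⟦⟧ᴿ-cong i | ⟦⟧ᴿ-cong j | ⋁-cong p
  ... | a , a' | b , b' | c , c' =
    ∨L (a ⨾ ∨I₁ ⨾ ∨I₂) (∨L (b ⨾ ∨I₁) (c ⨾ ∨I₂ ⨾ ∨I₂)) ,
    ∨L (b' ⨾ ∨I₁ ⨾ ∨I₂) (∨L (a' ⨾ ∨I₁) (c' ⨾ ∨I₂ ⨾ ∨I₂))
  ⋁-cong (trans≋ p q) with ⋁-cong p | ⋁-cong q
  ... | a , a' | b , b' = a ⨾ b , b' ⨾ a'

⋀-++ : ∀ Γ Γ' → ⋀ (Γ ++ Γ') ⇔ ⋀ Γ ∧ ⋀ Γ'
⋀-++ []      Γ' = ∧R ⊤R hyp , ∧E₂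
⋀-++ (i ∷ Γ) Γ' with ⋀-++ Γ Γ'
... | a , a' = (hyp ⟨∧⟩ a) ⨾ ∧-assocʳ , ∧-assocˡ ⨾ (hyp ⟨∧⟩ a')

⋁-++ : ∀ Δ Δ' → ⋁ (Δ ++ Δ') ⇔ ⋁ Δ ∨ ⋁ Δ'
⋁-++ []      Δ' = ∨I₂ , ∨L ⊥L hyp
⋁-++ (i ∷ Δ) Δ' with ⋁-++ Δ Δ'
... | a , a' = (hyp ⟨∨⟩ a) ⨾ ∨-assocʳ , ∨-assocˡ ⨾ (hyp ⟨∨⟩ a')

soundness : ∀ {Γ Δ} → N-LBiI (Γ ⊢ Δ) → ⋀ Γ ⇛ ⋁ Δ
soundness (perm (⊢≈ p q) d) = proj₂ (⋀-cong p) ⨾ soundness d ⨾ proj₁ (⋁-cong q)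
soundness hyp        = ∧E₁ ⨾ ∨I₁
soundness (cut d e)  = cut-⇛ (soundness d) (soundness e)
soundness (weakL d)  = ∧E₂ ⨾ soundness d
soundness (weakR d)  = soundness d ⨾ ∨I₂
soundness (contrL d) = ∧R ∧E₁ hyp ⨾ soundness d
soundness (contrR d) = soundness d ⨾ ∨L ∨I₁ hyp
soundness (⊤L d)     = ∧E₂ ⨾ soundness d
soundness ⊤R         = ⊤R ⨾ ∨I₁
soundness ⊥L         = ∧E₁ ⨾ ⊥L
soundness (⊥R d)     = soundness d ⨾ ∨I₂
soundness (∧L d)     = ∧-assocˡ ⨾ soundness d
soundness (∧R d e)   =
  ∧R (soundness d) (soundness e) ⨾ ∧-distribʳ-∨ ⨾ ∨L (∧-distribˡ-∨ ⨾ (hyp ⟨∨⟩ ∧E₂)) (∧E₁ ⨾ ∨I₂)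
soundness (∨L d e)   = ∧-distribʳ-∨ ⨾ ∨L (soundness d) (soundness e)
soundness (∨R d)     = soundness d ⨾ ∨-assocʳ
soundness (⊃L d e)   =
  cut-⇛ (soundness d) (∧R (∧R (∧E₂ ⨾ ∧E₁) ∧E₁ ⨾ ⊃E) (∧E₂ ⨾ ∧E₂) ⨾ soundness e)
soundness (⊃R d)     = ⊃I (∧-comm ⨾ soundness d ⨾ ∨L hyp ⊥L) ⨾ ∨I₁
soundness (-<L d)    = ∧E₁ ⨾ -<I (∧R hyp ⊤R ⨾ soundness d)
soundness (-<R d e)  =
  cut-⇛ (soundness d ⨾ (hyp ⟨∨⟩ ∨I₂)) ((-<E ⟨∧⟩ hyp) ⨾ ∧-distribʳ-∨ ⨾ ∨L (soundness e) (∧E₁ ⨾ ∨I₁))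
soundness (nestL {Δ = Δ} {Δ₀ = Δ₀} d) = ∧E₁ ⨾ -<I (soundness d ⨾ proj₁ (⋁-++ Δ₀ Δ))
soundness (nestR {Γ = Γ} {Γ₀ = Γ₀} d) = ⊃I (proj₂ (⋀-++ Γ Γ₀) ⨾ soundness d) ⨾ ∨I₁
soundness (unnestL {Γ = Γ} {Δ} {Γ₀} {Δ₀} d) =
  proj₁ (⋀-++ Γ Γ₀) ⨾ (hyp ⟨∧⟩ -<E) ⨾ ∧-comm ⨾ ∧-distribʳ-∨
    ⨾ ∨L (∧E₁ ⨾ ∨I₁) (soundness d ⨾ ∨I₂) ⨾ proj₂ (⋁-++ Δ₀ Δ)
soundness (unnestR {Γ = Γ} {Δ} {Γ₀} {Δ₀} d) =
  proj₁ (⋀-++ Γ Γ₀) ⨾ (soundness d ⟨∧⟩ hyp) ⨾ ∧-distribʳ-∨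
    ⨾ ∨L (⊃E ⨾ ∨I₁) (∧E₁ ⨾ ∨I₂) ⨾ proj₂ (⋁-++ Δ₀ Δ)

mutual
  ⊢⋀ : ∀ Γ X Y → N-LBiI (Γ ++ X ⊢ fm (⋀ Γ) ∷ Y)
  ⊢⋀ []      X Y = ⊤R
  ⊢⋀ (i ∷ Γ) X Y = ∧R (⊢⟦⟧ᴸ i (Γ ++ X) Y) (exchangeˡ (↭.shift i Γ X) (⊢⋀ Γ (i ∷ X) Y))

  ⊢⟦⟧ᴸ : ∀ i X Y → N-LBiI (i ∷ X ⊢ fm ⟦ i ⟧ᴸ ∷ Y)
  ⊢⟦⟧ᴸ (fm A)            X Y = hyp
  ⊢⟦⟧ᴸ (sq (Γ₀ ⊢ Δ₀)) X Y =
    nestL (exchangeʳ (↭-sym (↭.shift _ Δ₀ Y))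
      (-<R (exchangeˡ (↭.++-identityʳ Γ₀) (⊢⋀ Γ₀ [] (Δ₀ ++ Y)))
           (exchangeʳ (↭.shift _ Δ₀ Y) (⋁⊢ Δ₀ Γ₀ _))))

  ⋁⊢ : ∀ Δ X Y → N-LBiI (fm (⋁ Δ) ∷ X ⊢ Δ ++ Y)
  ⋁⊢ []      X Y = ⊥L
  ⋁⊢ (i ∷ Δ) X Y = ∨L (⟦⟧ᴿ⊢ i X (Δ ++ Y)) (exchangeʳ (↭.shift i Δ Y) (⋁⊢ Δ X (i ∷ Y)))

  ⟦⟧ᴿ⊢ : ∀ i X Y → N-LBiI (fm ⟦ i ⟧ᴿ ∷ X ⊢ i ∷ Y)
  ⟦⟧ᴿ⊢ (fm A)            X Y = hyp
  ⟦⟧ᴿ⊢ (sq (Γ₀ ⊢ Δ₀)) X Y =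
    nestR (⊃L (exchangeˡ (↭.trans (↭.shift _ Γ₀ X) (↭.prep _ (↭.++-comm Γ₀ X))) (⊢⋀ Γ₀ _ Δ₀))
              (exchangeʳ (↭.++-identityʳ Δ₀) (⋁⊢ Δ₀ (X ++ Γ₀) [])))

completeness : ∀ {Γ Δ} → ⋀ Γ ⇛ ⋁ Δ → N-LBiI (Γ ⊢ Δ)
completeness {Γ} {Δ} p =
  cut (exchangeˡ (↭.++-identityʳ Γ) (⊢⋀ Γ [] Δ))
      (cut (weaken Γ Δ p) (exchangeʳ (↭.++-identityʳ Δ) (⋁⊢ Δ _ [])))

reroot : ∀ {P Q P' Q'} → N-LBiI (P ⊢ sq (P' ⊢ Q') ∷ Q) → N-LBiI (sq (P ⊢ Q) ∷ P' ⊢ Q')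
reroot d = completeness ((-<I (soundness d ⨾ ∨-comm) ⟨∧⟩ hyp) ⨾ ⊃E)

reroot⁻¹ : ∀ {P Q P' Q'} → N-LBiI (sq (P ⊢ Q) ∷ P' ⊢ Q') → N-LBiI (P ⊢ sq (P' ⊢ Q') ∷ Q)
reroot⁻¹ d = completeness (-<E ⨾ (hyp ⟨∨⟩ ⊃I (soundness d)) ⨾ ∨-comm)

-- Walks and connected components

Reach : List Arc → ℕ → ℕ → Set
Reach as x y = Σ (List (Dir × ℕ)) λ ws → Walk as x ws y

walk-++ : ∀ {as x ws y vs z} → Walk as x ws y → Walk as y vs z → Walk as x (ws ++ vs) z
walk-++ stop       v = v
walk-++ (fwd∷ e w) v = fwd∷ e (walk-++ w v)
walk-++ (bwd∷ e w) v = bwd∷ e (walk-++ w v)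

walk-mono : ∀ {as bs x ws y} → (∀ {e} → e ∈ as → e ∈ bs) → Walk as x ws y → Walk bs x ws y
walk-mono as⊆bs stop       = stop
walk-mono as⊆bs (fwd∷ e w) = fwd∷ (as⊆bs e) (walk-mono as⊆bs w)
walk-mono as⊆bs (bwd∷ e w) = bwd∷ (as⊆bs e) (walk-mono as⊆bs w)

Reach-refl : ∀ {as x} → Reach as x x
Reach-refl = [] , stop

Reach-trans : ∀ {as x y z} → Reach as x y → Reach as y z → Reach as x z
Reach-trans (ws , w) (vs , v) = ws ++ vs , walk-++ w v

Reach-fwd : ∀ {as x y} → (x , y) ∈ as → Reach as x y
Reach-fwd e = _ , fwd∷ e stop

Reach-bwd : ∀ {as x y} → (y , x) ∈ as → Reach as x y
Reach-bwd e = _ , bwd∷ e stop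

Reach-mono : ∀ {as bs x y} → (∀ {e} → e ∈ as → e ∈ bs) → Reach as x y → Reach bs x y
Reach-mono as⊆bs (ws , w) = ws , walk-mono as⊆bs w

visited : ℕ → List (Dir × ℕ) → List ℕ
visited x ws = x ∷ map proj₂ ws

walk-from-visited : ∀ {as x ws y t} → Walk as x ws y → t ∈ visited x ws →
                    Σ (List (Dir × ℕ)) λ vs → Walk as t vs y ×
                      (Unique (visited x ws) → Unique (visited t vs))
walk-from-visited w (here refl) = _ , w , λ u → u
walk-from-visited (fwd∷ e w) (there t∈) with walk-from-visited w t∈
... | vs , w' , keep = vs , w' , λ { (_ ∷ u) → keep u }
walk-from-visited (bwd∷ e w) (there t∈) with walk-from-visited w t∈
... | vs , w' , keep = vs , w' , λ { (_ ∷ u) → keep u }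

-- Loops are cut out from the back: the path found for the tail is kept unless it
-- revisits the first node, in which case we jump there.
walk⇒path : ∀ {as x ws y} → Walk as x ws y → Σ (List (Dir × ℕ)) λ vs → IsPath as x vs y
walk⇒path stop = [] , stop , ([] ∷ [])
walk⇒path {x = x} (fwd∷ {z = z} e w) with walk⇒path w
... | vs , p , u with x ∈? visited z vs
...   | yes x∈ = let vs' , p' , keep = walk-from-visited p x∈ in vs' , p' , keep u
...   | no  x∉ = _ , fwd∷ e p , (¬Any⇒All¬ _ x∉ ∷ u)
walk⇒path {x = x} (bwd∷ {z = z} e w) with walk⇒path w
... | vs , p , u with x ∈? visited z vs
...   | yes x∈ = let vs' , p' , keep = walk-from-visited p x∈ in vs' , p' , keep u
...   | no  x∉ = _ , bwd∷ e p , (¬Any⇒All¬ _ x∉ ∷ u)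

length-remove : ∀ {A : Set} (xs : List A) {x ys} → length (xs ++ x ∷ ys) ≡ suc (length (xs ++ ys))
length-remove []       = refl
length-remove (_ ∷ xs) = cong suc (length-remove xs)

Unique-⊆⇒length≤ : ∀ {A : Set} {xs ys : List A} → Unique xs → (∀ {t} → t ∈ xs → t ∈ ys) →
                    length xs ≤ length ys
Unique-⊆⇒length≤ {xs = []}     _        _     = z≤n
Unique-⊆⇒length≤ {xs = x ∷ xs} (x∉ ∷ u) xs⊆ys with ∈-∃++ (xs⊆ys (here refl))
... | ys₁ , ys₂ , refl =
  subst (suc (length xs) ≤_) (sym (length-remove ys₁)) (s≤s (Unique-⊆⇒length≤ u xs⊆ys₁++ys₂))
  where
  xs⊆ys₁++ys₂ : ∀ {t} → t ∈ xs → t ∈ ys₁ ++ ys₂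
  xs⊆ys₁++ys₂ t∈ with ∈-++⁻ ys₁ (xs⊆ys (there t∈))
  ... | inj₁ p           = ∈-++⁺ˡ p
  ... | inj₂ (here refl) = ⊥-elim (All.lookup x∉ t∈ refl)
  ... | inj₂ (there p)   = ∈-++⁺ʳ ys₁ p

Closed : List ℕ → List Arc → Set
Closed K as = ∀ {a b} → (a , b) ∈ as → a ∈ K × b ∈ K

walk-visits-closed : ∀ {as x ws y K} → Closed K as → x ∈ K → Walk as x ws y →
                     ∀ {t} → t ∈ visited x ws → t ∈ K
walk-visits-closed cl x∈ w          (here refl) = x∈
walk-visits-closed cl x∈ (fwd∷ e w) (there t∈)  = walk-visits-closed cl (proj₂ (cl e)) w t∈
walk-visits-closed cl x∈ (bwd∷ e w) (there t∈)  = walk-visits-closed cl (proj₁ (cl e)) w t∈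

short-walk : ∀ {as x y} K → Closed K as → x ∈ K → Reach as x y →
             Σ (List (Dir × ℕ)) λ ws → Walk as x ws y × suc (length ws) ≤ length K
short-walk K cl x∈ (_ , w) with walk⇒path w
... | vs , p , u = vs , p ,
  subst (_≤ length K) (cong suc (length-map proj₂ vs))
    (Unique-⊆⇒length≤ u (walk-visits-closed cl x∈ p))

Adjacent : List Arc → ℕ → ℕ → Set
Adjacent as s t = (s , t) ∈ as ⊎ (t , s) ∈ as

Adjacent⇒Reach : ∀ {as s t} → Adjacent as s t → Reach as s t
Adjacent⇒Reach (inj₁ e) = Reach-fwd e
Adjacent⇒Reach (inj₂ e) = Reach-bwd e

-- reachStep computes with a local helper that is not in scope; we recover it by
-- unification against the unfolded definition.
neighbours : List Arc → List ℕ → Arc → List ℕ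
neighbours as S = proj₁ {B = λ F → reachStep as S ≡ S ++ concatMap F as} (_ , refl)

∈-neighbours⁻ : ∀ as S a b {t} → t ∈ neighbours as S (a , b) →
                a ∈ S × t ≡ b ⊎ b ∈ S × t ≡ a
∈-neighbours⁻ as S a b t∈ with a ∈? S | b ∈? S | t∈
... | yes a∈ | _      | here refl         = inj₁ (a∈ , refl)
... | yes _  | yes b∈ | there (here refl) = inj₂ (b∈ , refl)
... | no _   | yes b∈ | here refl         = inj₂ (b∈ , refl)

∈-neighbours⁺ : ∀ as S a b → a ∈ S → b ∈ neighbours as S (a , b) × b ∈ neighbours as S (b , a)
∈-neighbours⁺ as S a b a∈ with a ∈? S
... | no a∉ = ⊥-elim (a∉ a∈)
... | yes _ = here refl , ∈-++⁺ʳ _ (here refl)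

∈-reachStep⁻ : ∀ as S {t} → t ∈ reachStep as S → t ∈ S ⊎ Σ ℕ λ s → s ∈ S × Adjacent as s t
∈-reachStep⁻ as S t∈ with ∈-++⁻ S t∈
... | inj₁ t∈S = inj₁ t∈S
... | inj₂ t∈step with find (∈-concatMap⁻ (neighbours as S) {xs = as} t∈step)
... | (a , b) , ab∈ , t∈ab with ∈-neighbours⁻ as S a b t∈ab
... | inj₁ (a∈ , refl) = inj₂ (a , a∈ , inj₁ ab∈)
... | inj₂ (b∈ , refl) = inj₂ (b , b∈ , inj₂ ab∈)

∈-reachStep⁺ : ∀ as S {s t} → s ∈ S → Adjacent as s t → t ∈ reachStep as S
∈-reachStep⁺ as S {s} {t} s∈ adj = ∈-++⁺ʳ S (∈-concatMap⁺ (neighbours as S) (step adj))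
  where
  step : Adjacent as s t → Any (λ e → t ∈ neighbours as S e) as
  step (inj₁ st∈) = Any.map (λ { refl → proj₁ (∈-neighbours⁺ as S s t s∈) }) st∈
  step (inj₂ ts∈) = Any.map (λ { refl → proj₂ (∈-neighbours⁺ as S s t s∈) }) ts∈

reach-⊇ : ∀ k as {S t} → t ∈ S → t ∈ reach k as S
reach-⊇ zero    as t∈ = t∈
reach-⊇ (suc k) as t∈ = reach-⊇ k as (∈-++⁺ˡ t∈)

∈-reach⁻ : ∀ k as {S t} → t ∈ reach k as S → Σ ℕ λ s → s ∈ S × Reach as s t
∈-reach⁻ zero    as t∈ = _ , t∈ , Reach-refl
∈-reach⁻ (suc k) as {S} t∈ with ∈-reach⁻ k as t∈
... | s' , s'∈ , s'↝t with ∈-reachStep⁻ as S s'∈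
...   | inj₁ s'∈S            = s' , s'∈S , s'↝t
...   | inj₂ (s , s∈ , adj) = s , s∈ , Reach-trans (Adjacent⇒Reach adj) s'↝t

∈-reach⁺ : ∀ k as {S s ws t} → s ∈ S → Walk as s ws t → length ws ≤ k → t ∈ reach k as S
∈-reach⁺ k       as s∈ stop       _       = reach-⊇ k as s∈
∈-reach⁺ (suc k) as s∈ (fwd∷ e w) (s≤s l) = ∈-reach⁺ k as (∈-reachStep⁺ as _ s∈ (inj₁ e)) w l
∈-reach⁺ (suc k) as s∈ (bwd∷ e w) (s≤s l) = ∈-reach⁺ k as (∈-reachStep⁺ as _ s∈ (inj₂ e)) w l

∈-component⁻ : ∀ K as y {t} → t ∈ component K as y → t ∈ K × Reach as y t
∈-component⁻ K as y t∈ with ∈-filter⁻ (_∈? reach (length K) as [ y ]) {xs = K} t∈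
... | t∈K , t∈reach with ∈-reach⁻ (length K) as t∈reach
...   | _ , here refl , y↝t = t∈K , y↝t

∈-component⁺ : ∀ K as y {t} → Closed K as → y ∈ K → t ∈ K → Reach as y t → t ∈ component K as y
∈-component⁺ K as y cl y∈ t∈ y↝t with short-walk K cl y∈ y↝t
... | _ , w , short = ∈-filter⁺ (_∈? reach (length K) as [ y ]) t∈
                        (∈-reach⁺ (length K) as (here refl) w (≤-trans (n≤1+n _) short))

module _ {A : Set} where

  filter-cong-∈ : ∀ {P Q : A → Set} (P? : Decidable P) (Q? : Decidable Q) xs →
                  (∀ {t} → t ∈ xs → (P t → Q t) × (Q t → P t)) → filter P? xs ≡ filter Q? xs
  filter-cong-∈ P? Q? []       P⇔Q = refl
  filter-cong-∈ P? Q? (x ∷ xs) P⇔Q with P? x | Q? x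
  ... | yes _  | yes _  = cong (x ∷_) (filter-cong-∈ P? Q? xs (λ t∈ → P⇔Q (there t∈)))
  ... | no _   | no _   = filter-cong-∈ P? Q? xs (λ t∈ → P⇔Q (there t∈))
  ... | yes px | no ¬qx = ⊥-elim (¬qx (proj₁ (P⇔Q (here refl)) px))
  ... | no ¬px | yes qx = ⊥-elim (¬px (proj₂ (P⇔Q (here refl)) qx))

  filter-filter : ∀ {P Q : A → Set} (P? : Decidable P) (Q? : Decidable Q) xs →
                  filter P? (filter Q? xs) ≡ filter (λ t → P? t ×-dec Q? t) xs
  filter-filter P? Q? [] = refl
  filter-filter P? Q? (x ∷ xs) with Q? x
  ... | yes _ with P? x
  ...   | yes _ = cong (x ∷_) (filter-filter P? Q? xs)
  ...   | no _  = filter-filter P? Q? xs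
  filter-filter P? Q? (x ∷ xs) | no _ with P? x
  ...   | yes _ = filter-filter P? Q? xs
  ...   | no _  = filter-filter P? Q? xs

  filter-filter-⇒ : ∀ {P Q : A → Set} (P? : Decidable P) (Q? : Decidable Q) xs →
                    (∀ {t} → t ∈ xs → P t → Q t) → filter P? (filter Q? xs) ≡ filter P? xs
  filter-filter-⇒ P? Q? xs P⇒Q = trans (filter-filter P? Q? xs)
    (filter-cong-∈ _ P? xs (λ t∈ → proj₁ , λ p → p , P⇒Q t∈ p))

  filter-by-membership : ∀ {P : A → Set} (P? : Decidable P) (_∈?_ : ∀ t L → Dec (t ∈ L)) {L} xs →
                         L ≡ filter P? xs → L ≡ filter (_∈? L) xs
  filter-by-membership P? _∈?_ xs refl = filter-cong-∈ P? (_∈? filter P? xs) xs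
    (λ t∈ → ∈-filter⁺ P? t∈ , λ p → proj₂ (∈-filter⁻ P? {xs = xs} p))

module _ {A B : Set} where

  concatMap-cong-∈ : ∀ {f g : A → List B} xs → (∀ {a} → a ∈ xs → f a ≡ g a) →
                     concatMap f xs ≡ concatMap g xs
  concatMap-cong-∈ []       f≗g = refl
  concatMap-cong-∈ (x ∷ xs) f≗g =
    cong₂ _++_ (f≗g (here refl)) (concatMap-cong-∈ xs (λ a∈ → f≗g (there a∈)))

  concatMap-filter-cong : ∀ {P Q : A → Set} (P? : Decidable P) (Q? : Decidable Q)
                          {f g : A → List B} xs →
                          (∀ {a} → a ∈ xs → P a → Q a × f a ≡ g a) →
                          (∀ {a} → a ∈ xs → Q a → ¬ P a → g a ≡ []) →
                          concatMap f (filter P? xs) ≡ concatMap g (filter Q? xs)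
  concatMap-filter-cong P? Q? []       same extra = refl
  concatMap-filter-cong P? Q? {g = g} (x ∷ xs) same extra
    with P? x | Q? x | concatMap-filter-cong P? Q? xs (λ a∈ → same (there a∈)) (λ a∈ → extra (there a∈))
  ... | yes p | yes q | ih = cong₂ _++_ (proj₂ (same (here refl) p)) ih
  ... | yes p | no ¬q | _  = ⊥-elim (¬q (proj₁ (same (here refl) p)))
  ... | no ¬p | yes q | ih = trans ih (cong (_++ concatMap g (filter Q? xs)) (sym (extra (here refl) q ¬p)))
  ... | no _  | no _  | ih = ih

  concatMap-↭-pick : (_≟_ : DecidableEquality A) (f : A → List B) {a : A} {xs : List A} →
                     Unique xs → a ∈ xs → concatMap f xs ↭ f a ++ concatMap f (filter (λ e → ¬? (e ≟ a)) xs)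
  concatMap-↭-pick _≟_ f {a} {x ∷ xs} (x∉ ∷ _) (here refl) with x ≟ x
  ... | no x≢x = ⊥-elim (x≢x refl)
  ... | yes _  = ↭.++⁺ˡ (f x) (↭-reflexive (cong (concatMap f) (sym
                   (filter-all (λ e → ¬? (e ≟ x)) (All.map (λ x≢e e≡x → x≢e (sym e≡x)) x∉)))))
  concatMap-↭-pick _≟_ f {a} {x ∷ xs} (x∉ ∷ u) (there a∈) with x ≟ a
  ... | yes refl = ⊥-elim (All.lookup x∉ a∈ refl)
  ... | no _     = ↭.trans (↭.++⁺ˡ (f x) (concatMap-↭-pick _≟_ f u a∈)) (↭.shifts (f x) (f a))

-- The translation on subtrees of a label tree

Joins : Arc → ℕ → ℕ → Set
Joins e x y = e ≡ (x , y) ⊎ e ≡ (y , x)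

Joins-sym : ∀ {e x y} → Joins e x y → Joins e y x
Joins-sym (inj₁ e≡) = inj₂ e≡
Joins-sym (inj₂ e≡) = inj₁ e≡

Joins⇒Reach : ∀ {as e x y} → e ∈ as → Joins e x y → Reach as x y
Joins⇒Reach e∈ (inj₁ refl) = Reach-fwd e∈
Joins⇒Reach e∈ (inj₂ refl) = Reach-bwd e∈

Joins-endpoint : ∀ {e x y r p} → Joins e x y → Joins e r p → r ≡ x ⊎ r ≡ y
Joins-endpoint (inj₁ refl) (inj₁ refl) = inj₁ refl
Joins-endpoint (inj₁ refl) (inj₂ refl) = inj₂ refl
Joins-endpoint (inj₂ refl) (inj₁ refl) = inj₂ refl
Joins-endpoint (inj₂ refl) (inj₂ refl) = inj₁ refl

Adjacent-map : ∀ {as bs s t} → (∀ {e} → e ∈ as → Joins e s t → e ∈ bs) →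
               Adjacent as s t → Adjacent bs s t
Adjacent-map f (inj₁ e∈) = inj₁ (f e∈ (inj₁ refl))
Adjacent-map f (inj₂ e∈) = inj₂ (f e∈ (inj₂ refl))

infixl 5 _∖_
_∖_ : List Arc → Arc → List Arc
as ∖ b = filter (λ e → ¬? (e ≟ₐ b)) as

∈-∖⁻ : ∀ as {e b} → e ∈ as ∖ b → e ∈ as × e ≢ b
∈-∖⁻ as {b = b} = ∈-filter⁻ (λ e → ¬? (e ≟ₐ b)) {xs = as}

∈-∖⁺ : ∀ {e as b} → e ∈ as → e ≢ b → e ∈ as ∖ b
∈-∖⁺ {b = b} = ∈-filter⁺ (λ e → ¬? (e ≟ₐ b))

antecedent succedent : Seq → Ctx
antecedent (Γ ⊢ _) = Γ
succedent  (_ ⊢ Δ) = Δ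

-- Likewise for the local helpers of transl.
transl-inAnt transl-inSuc : ℕ → List ℕ → List Arc → LFms → LFms → ℕ → Arc → List Item
transl-inAnt n K as Γ Δ x =
  proj₁ {B = λ F → antecedent (transl (suc n) K as Γ Δ x) ≡ at x Γ ++ concatMap F as} (_ , refl)
transl-inSuc n K as Γ Δ x =
  proj₁ {B = λ F → succedent (transl (suc n) K as Γ Δ x) ≡ at x Δ ++ concatMap F as} (_ , refl)

module Translation (G : LabelTree) (Γ Δ : LFms) where

  N : List ℕ
  N = nodes G

  E : List Arc
  E = arcs G

  Closed-E : Closed N E
  Closed-E e = arcs-src G e , arcs-tgt G e

  Joins-nodes : ∀ {e x y} → e ∈ E → Joins e x y → x ∈ N × y ∈ N
  Joins-nodes e∈ (inj₁ refl) = Closed-E e∈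
  Joins-nodes e∈ (inj₂ refl) = proj₂ (Closed-E e∈) , proj₁ (Closed-E e∈)

  Joins-≢ : ∀ {e x y} → e ∈ E → Joins e x y → x ≢ y
  Joins-≢ e∈ (inj₁ refl) refl = no-loops G e∈
  Joins-≢ e∈ (inj₂ refl) refl = no-loops G e∈

  -- The one-arc path from x to y is the only path, so every path uses the arc.
  arc-removal-disconnects : ∀ {e x y} → e ∈ E → Joins e x y → ¬ Reach (E ∖ e) x y
  arc-removal-disconnects {e} {x} {y} e∈ joins (_ , w) with walk⇒path w
  ... | vs , p , u with Joins-nodes e∈ joins
  ...   | x∈ , y∈ with unique-path G x y x∈ y∈
  ...   | _ , _ , only = proj₂ (∈-∖⁻ E (go joins vs p u)) refl
    where
    x≢y = Joins-≢ e∈ joins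
    p⊆E : ∀ {vs} → Walk (E ∖ e) x vs y → Walk E x vs y
    p⊆E = walk-mono (λ e∈ → proj₁ (∈-∖⁻ E e∈))
    go : Joins e x y → ∀ vs → Walk (E ∖ e) x vs y → Unique (visited x vs) → e ∈ E ∖ e
    go (inj₁ refl) vs p u
      with trans (only vs (p⊆E p , u)) (sym (only _ (fwd∷ e∈ stop , (x≢y ∷ []) ∷ [] ∷ [])))
    go (inj₁ refl) _ (fwd∷ e∈E∖e stop) u | refl = e∈E∖e
    go (inj₂ refl) vs p u
      with trans (only vs (p⊆E p , u)) (sym (only _ (bwd∷ e∈ stop , (x≢y ∷ []) ∷ [] ∷ [])))
    go (inj₂ refl) _ (bwd∷ e∈E∖e stop) u | refl = e∈E∖e

  BothIn : List ℕ → Arc → Set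
  BothIn K e = proj₁ e ∈ K × proj₂ e ∈ K

  arcsIn : List ℕ → List Arc
  arcsIn K = filter (λ e → (proj₁ e ∈? K) ×-dec (proj₂ e ∈? K)) E

  ∈-arcsIn⁻ : ∀ {K e} → e ∈ arcsIn K → e ∈ E × BothIn K e
  ∈-arcsIn⁻ {K} = ∈-filter⁻ (λ e → (proj₁ e ∈? K) ×-dec (proj₂ e ∈? K)) {xs = E}

  ∈-arcsIn⁺ : ∀ {K e} → e ∈ E → BothIn K e → e ∈ arcsIn K
  ∈-arcsIn⁺ {K} = ∈-filter⁺ (λ e → (proj₁ e ∈? K) ×-dec (proj₂ e ∈? K))

  arcsIn-nodes : arcsIn N ≡ E
  arcsIn-nodes = filter-all _ (All.tabulate (λ { {_ , _} e∈ → Closed-E e∈ }))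

  Joins-BothIn : ∀ {K e x y} → Joins e x y → x ∈ K → y ∈ K → BothIn K e
  Joins-BothIn (inj₁ refl) x∈ y∈ = x∈ , y∈
  Joins-BothIn (inj₂ refl) x∈ y∈ = y∈ , x∈

  BothIn-Joins : ∀ {K e x y} → BothIn K e → Joins e x y → x ∈ K × y ∈ K
  BothIn-Joins (a∈ , b∈) (inj₁ refl) = a∈ , b∈
  BothIn-Joins (a∈ , b∈) (inj₂ refl) = b∈ , a∈

  -- The nodes of the paper's  G_w  for the arc e, inside the subtree on K.
  side : List ℕ → Arc → ℕ → List ℕ
  side K e w = component K (arcsIn K ∖ e) w

  side-⊆ : ∀ K e w {t} → t ∈ side K e w → t ∈ K
  side-⊆ K e w t∈ = proj₁ (∈-component⁻ K (arcsIn K ∖ e) w t∈)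

  -- Node lists are kept in the order of  N , so that equal sets are equal lists.
  Canonical : List ℕ → Set
  Canonical K = K ≡ filter (_∈? K) N

  Canonical-≡ : ∀ {K K'} → Canonical K → Canonical K' →
                (∀ {t} → t ∈ N → (t ∈ K → t ∈ K') × (t ∈ K' → t ∈ K)) → K ≡ K'
  Canonical-≡ {K} {K'} canK canK' K⇔K' =
    trans canK (trans (filter-cong-∈ (_∈? K) (_∈? K') N K⇔K') (sym canK'))

  record Branch (K : List ℕ) (r : ℕ) : Set where
    field
      arc      : Arc
      far      : ℕ
      arc∈     : arc ∈ E
      arc-joins : Joins arc r far
      reached  : ∀ {t} → t ∈ K → Reach (E ∖ arc) r t
      reaching : ∀ {t} → t ∈ N → Reach (E ∖ arc) r t → t ∈ K

  -- The node sets on which the translation recurses: all of G, or the part of G on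
  -- the side of r of an arc at r.
  record Subtree (K : List ℕ) (r : ℕ) : Set where
    field
      ⊆N        : ∀ {t} → t ∈ K → t ∈ N
      root∈     : r ∈ K
      canonical : Canonical K
      whole-or-branch : (∀ {t} → t ∈ N → t ∈ K) ⊎ Branch K r

  whole : ∀ {r} → r ∈ N → Subtree N r
  whole r∈ = record
    { ⊆N              = λ t∈ → t∈
    ; root∈           = r∈
    ; canonical       = sym (filter-all (_∈? N) (All.tabulate (λ t∈ → t∈)))
    ; whole-or-branch = inj₁ (λ t∈ → t∈)
    }

  module Side {K r} (S : Subtree K r) {e w} (e∈ : e ∈ arcsIn K) (e-joins : Joins e r w) where
    open Subtree S

    e∈E : e ∈ E
    e∈E = proj₁ (∈-arcsIn⁻ e∈)

    w∈K : w ∈ K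
    w∈K = proj₂ (BothIn-Joins (proj₂ (∈-arcsIn⁻ e∈)) e-joins)

    r-unreachable : ¬ Reach (E ∖ e) w r
    r-unreachable = arc-removal-disconnects e∈E (Joins-sym e-joins)

    ∈-side⁻ : ∀ {t} → t ∈ side K e w → t ∈ N × Reach (E ∖ e) w t
    ∈-side⁻ t∈ with ∈-component⁻ K (arcsIn K ∖ e) w t∈
    ... | t∈K , w↝t = ⊆N t∈K , Reach-mono ⊆E∖e w↝t
      where
      ⊆E∖e : ∀ {a} → a ∈ arcsIn K ∖ e → a ∈ E ∖ e
      ⊆E∖e a∈ = let a∈K , a≢e = ∈-∖⁻ (arcsIn K) a∈ in ∈-∖⁺ (proj₁ (∈-arcsIn⁻ a∈K)) a≢e

    root∉ : r ∉ side K e w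
    root∉ r∈ = r-unreachable (proj₂ (∈-side⁻ r∈))

    lift-whole : (∀ {t} → t ∈ N → t ∈ K) → ∀ {a} → a ∈ E ∖ e → a ∈ arcsIn K ∖ e
    lift-whole all a∈ with ∈-∖⁻ E a∈
    ... | a∈E , a≢e = ∈-∖⁺ (∈-arcsIn⁺ a∈E (all (proj₁ (Closed-E a∈E)) , all (proj₂ (Closed-E a∈E)))) a≢e

    -- Walks from w avoiding e never come back to r, hence never use the arc that
    -- cuts K off and stay within K.
    module InBranch (B : Branch K r) where
      open Branch B

      e≢arc : e ≢ arc
      e≢arc refl = arc-removal-disconnects arc∈ arc-joins (reached far∈K)
        where far∈K = proj₂ (BothIn-Joins (proj₂ (∈-arcsIn⁻ e∈)) arc-joins)

      follow : ∀ {s ws t} → Walk (E ∖ e) s ws t → Reach (E ∖ e) w s → Reach (E ∖ arc) r s → s ∈ K →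
               t ∈ K × Reach (arcsIn K ∖ e) s t
      step : ∀ {s z ws t} → Adjacent (E ∖ e) s z → Walk (E ∖ e) z ws t →
             Reach (E ∖ e) w s → Reach (E ∖ arc) r s → s ∈ K → t ∈ K × Reach (arcsIn K ∖ e) s t

      follow stop           _   _   s∈ = s∈ , Reach-refl
      follow (fwd∷ a∈ walk) w↝s r↝s s∈ = step (inj₁ a∈) walk w↝s r↝s s∈
      follow (bwd∷ a∈ walk) w↝s r↝s s∈ = step (inj₂ a∈) walk w↝s r↝s s∈

      step {s} {z} {t = t} adj walk w↝s r↝s s∈ =
        proj₁ z⇝ , Reach-trans (Adjacent⇒Reach (Adjacent-map into-K adj)) (proj₂ z⇝)
        where
        w↝z : Reach (E ∖ e) w z
        w↝z = Reach-trans w↝s (Adjacent⇒Reach adj)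

        not-arc : ∀ {a} → Joins a s z → a ≢ arc
        not-arc j refl with Joins-endpoint j arc-joins
        ... | inj₁ refl = r-unreachable w↝s
        ... | inj₂ refl = r-unreachable w↝z

        avoids-arc : ∀ {a} → a ∈ E ∖ e → Joins a s z → a ∈ E ∖ arc
        avoids-arc a∈ j = ∈-∖⁺ (proj₁ (∈-∖⁻ E a∈)) (not-arc j)

        r↝z : Reach (E ∖ arc) r z
        r↝z = Reach-trans r↝s (Adjacent⇒Reach (Adjacent-map avoids-arc adj))

        z∈N : z ∈ N
        z∈N = [ (λ a∈ → proj₂ (Closed-E (proj₁ (∈-∖⁻ E a∈))))
              , (λ a∈ → proj₁ (Closed-E (proj₁ (∈-∖⁻ E a∈)))) ]′ adj

        z∈K : z ∈ K
        z∈K = reaching z∈N r↝z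

        z⇝ : t ∈ K × Reach (arcsIn K ∖ e) z t
        z⇝ = follow walk w↝z r↝z z∈K

        into-K : ∀ {a} → a ∈ E ∖ e → Joins a s z → a ∈ arcsIn K ∖ e
        into-K a∈ j = ∈-∖⁺ (∈-arcsIn⁺ (proj₁ (∈-∖⁻ E a∈)) (Joins-BothIn j s∈ z∈K)) (proj₂ (∈-∖⁻ E a∈))

    stays : ∀ {t} → t ∈ N → Reach (E ∖ e) w t → t ∈ K × Reach (arcsIn K ∖ e) w t
    stays t∈ (_ , walk) with whole-or-branch
    ... | inj₁ all = all t∈ , Reach-mono (lift-whole all) (_ , walk)
    ... | inj₂ B   = follow walk Reach-refl (Joins⇒Reach (∈-∖⁺ e∈E e≢arc) e-joins) w∈K
      where open InBranch B

    ∈-side⁺ : ∀ {t} → t ∈ N → Reach (E ∖ e) w t → t ∈ side K e w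
    ∈-side⁺ t∈ w↝t with stays t∈ w↝t
    ... | t∈K , w↝t' = ∈-component⁺ K (arcsIn K ∖ e) w closed w∈K t∈K w↝t'
      where
      closed : Closed K (arcsIn K ∖ e)
      closed a∈ = proj₂ (∈-arcsIn⁻ (proj₁ (∈-∖⁻ (arcsIn K) a∈)))

    in-side? : Decidable (_∈ reach (length K) (arcsIn K ∖ e) [ w ])
    in-side? = _∈? reach (length K) (arcsIn K ∖ e) [ w ]

    subtree : Subtree (side K e w) w
    subtree = record
      { ⊆N              = λ t∈ → proj₁ (∈-side⁻ t∈)
      ; root∈           = ∈-side⁺ (⊆N w∈K) Reach-refl
      ; canonical       = filter-by-membership _ _∈?_ N
                            (trans (cong (filter in-side?) canonical) (filter-filter in-side? (_∈? K) N))
      ; whole-or-branch = inj₂ (record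
          { arc = e ; far = r ; arc∈ = e∈E ; arc-joins = Joins-sym e-joins
          ; reached = λ t∈ → proj₂ (∈-side⁻ t∈) ; reaching = ∈-side⁺ })
      }

    smaller : length (side K e w) < length K
    smaller = filter-notAll in-side? K (Any.map (λ { refl r∈ → root∉ (∈-filter⁺ in-side? root∈ r∈) }) root∈)

  translIn : ℕ → List ℕ → ℕ → Seq
  translIn n K r = transl n K (arcsIn K) (restrict K Γ) (restrict K Δ) r

  antItems sucItems : ℕ → List ℕ → ℕ → Arc → List Item
  antItems n K r (y , x) with x ≟ r
  ... | yes _ = [ sq (translIn n (side K (y , x) y) y) ]
  ... | no  _ = []
  sucItems n K r (x , y) with x ≟ r
  ... | yes _ = [ sq (translIn n (side K (x , y) y) y) ]
  ... | no  _ = []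

  assemble : ℕ → List ℕ → ℕ → List Arc → Seq
  assemble n K r as =
    (at r Γ ++ concatMap (antItems n K r) as) ⊢ (at r Δ ++ concatMap (sucItems n K r) as)

  transl-cong : ∀ {n K as as' Γ₁ Γ₂ Δ₁ Δ₂ x} → as ≡ as' → Γ₁ ≡ Γ₂ → Δ₁ ≡ Δ₂ →
                transl n K as Γ₁ Δ₁ x ≡ transl n K as' Γ₂ Δ₂ x
  transl-cong refl refl refl = refl

  module _ {K r} (S : Subtree K r) where
    open Subtree S

    at-restrict : ∀ Θ → at r (restrict K Θ) ≡ at r Θ
    at-restrict Θ = cong (map (λ p → fm (proj₂ p)))
      (filter-filter-⇒ (λ p → proj₁ p ≟ r) (λ p → proj₁ p ∈? K) Θ (λ { _ refl → root∈ }))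

    translIn-sub : ∀ {n e y} → e ∈ arcsIn K → Joins e r y → let C = side K e y in
                   transl n C (filter (λ a → (proj₁ a ∈? C) ×-dec (proj₂ a ∈? C)) (arcsIn K ∖ e))
                     (restrict C (restrict K Γ)) (restrict C (restrict K Δ)) y
                   ≡ translIn n C y
    translIn-sub {e = e} {y} e∈ e-joins = transl-cong
      (trans (filter-filter-⇒ inside? _ (arcsIn K) not-e) (filter-filter-⇒ inside? _ E in-K))
      (filter-filter-⇒ (λ p → proj₁ p ∈? C) (λ p → proj₁ p ∈? K) Γ (λ _ → side-⊆ K e y))
      (filter-filter-⇒ (λ p → proj₁ p ∈? C) (λ p → proj₁ p ∈? K) Δ (λ _ → side-⊆ K e y))
      where
      open Side S e∈ e-joins using (root∉)
      C = side K e y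
      inside? = λ (a : Arc) → (proj₁ a ∈? C) ×-dec (proj₂ a ∈? C)
      not-e : ∀ {a} → a ∈ arcsIn K → BothIn C a → ¬ a ≡ e
      not-e _ a-in refl = root∉ (proj₁ (BothIn-Joins a-in e-joins))
      in-K : ∀ {a} → a ∈ E → BothIn C a → BothIn K a
      in-K _ (s∈ , t∈) = side-⊆ K e y s∈ , side-⊆ K e y t∈

    unfold : ∀ n → translIn (suc n) K r ≡ assemble n K r (arcsIn K)
    unfold n = cong₂ _⊢_ (cong₂ _++_ (at-restrict Γ) (concatMap-cong-∈ (arcsIn K) ant))
                         (cong₂ _++_ (at-restrict Δ) (concatMap-cong-∈ (arcsIn K) suc'))
      where
      ant : ∀ {e} → e ∈ arcsIn K →
            transl-inAnt n K (arcsIn K) (restrict K Γ) (restrict K Δ) r e ≡ antItems n K r e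
      ant {y , x} e∈ with x ≟ r
      ... | no  _    = refl
      ... | yes refl = cong (λ T → [ sq T ]) (translIn-sub e∈ (inj₂ refl))
      suc' : ∀ {e} → e ∈ arcsIn K →
             transl-inSuc n K (arcsIn K) (restrict K Γ) (restrict K Δ) r e ≡ sucItems n K r e
      suc' {x , y} e∈ with x ≟ r
      ... | no  _    = refl
      ... | yes refl = cong (λ T → [ sq T ]) (translIn-sub e∈ (inj₁ refl))

  translIn-fuel : ∀ {K r} → Subtree K r → ∀ n m → length K < n → length K < m →
                  translIn n K r ≡ translIn m K r
  translIn-fuel {K} {r} S (suc n) (suc m) (s≤s K<n) (s≤s K<m) =
    trans (unfold S n) (trans (cong₂ _⊢_ (cong (at r Γ ++_) (concatMap-cong-∈ (arcsIn K) ant))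
                                         (cong (at r Δ ++_) (concatMap-cong-∈ (arcsIn K) suc')))
                              (sym (unfold S m)))
    where
    recurse : ∀ {e w} → e ∈ arcsIn K → Joins e r w → translIn n (side K e w) w ≡ translIn m (side K e w) w
    recurse e∈ j = translIn-fuel subtree n m (<-≤-trans smaller K<n) (<-≤-trans smaller K<m)
      where open Side S e∈ j
    ant : ∀ {e} → e ∈ arcsIn K → antItems n K r e ≡ antItems m K r e
    ant {y , x} e∈ with x ≟ r
    ... | no  _    = refl
    ... | yes refl = cong (λ T → [ sq T ]) (recurse e∈ (inj₂ refl))
    suc' : ∀ {e} → e ∈ arcsIn K → sucItems n K r e ≡ sucItems m K r e
    suc' {x , y} e∈ with x ≟ r
    ... | no  _    = refl
    ... | yes refl = cong (λ T → [ sq T ]) (recurse e∈ (inj₁ refl))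

  side-unique : ∀ {K r K' r' e w} → Subtree K r → Subtree K' r' → e ∈ arcsIn K → e ∈ arcsIn K' →
                Joins e r w → Joins e r' w → side K e w ≡ side K' e w
  side-unique S S' e∈ e∈' j j' = Canonical-≡ (canonical A.subtree) (canonical B.subtree)
    (λ t∈ → (λ t∈A → B.∈-side⁺ t∈ (proj₂ (A.∈-side⁻ t∈A)))
          , (λ t∈B → A.∈-side⁺ t∈ (proj₂ (B.∈-side⁻ t∈B))))
    where
    open Subtree
    module A = Side S e∈ j
    module B = Side S' e∈' j'

  module _ {a y' y} (a∈ : a ∈ E) (a-joins : Joins a y' y) (k : ℕ) (|N| : length N ≡ suc k) where
    private
      a∈N : a ∈ arcsIn N
      a∈N = subst (a ∈_) (sym arcsIn-nodes) a∈

      y∈N : y ∈ N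
      y∈N = proj₂ (Joins-nodes a∈ a-joins)

      open Side (whole (proj₁ (Joins-nodes a∈ a-joins))) a∈N a-joins
      C = side N a y

      |C|≤k : length C ≤ k
      |C|≤k = ≤-pred (subst (length C <_) |N| smaller)

      same-sub : ∀ {e w} → e ∈ E → BothIn C e → (j : Joins e y w) →
                 translIn k (side C e w) w ≡ translIn (suc k) (side N e w) w
      same-sub {e} {w} e∈ e-in j =
        trans (cong (λ K → translIn k K w) sides≡)
              (translIn-fuel D.subtree k (suc k) bound (<-trans bound ≤-refl))
        where
        e∈C = ∈-arcsIn⁺ e∈ e-in
        e∈N = ∈-arcsIn⁺ e∈ (Joins-BothIn j y∈N (proj₂ (Joins-nodes e∈ j)))
        module D = Side (whole y∈N) e∈N j
        sides≡ = side-unique subtree (whole y∈N) e∈C e∈N j j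
        bound : length (side N e w) < k
        bound = subst (λ K → length K < k) sides≡ (<-≤-trans (Side.smaller subtree e∈C j) |C|≤k)

      not-a : ∀ {e} → BothIn C e → e ≢ a
      not-a e-in refl = root∉ (proj₁ (BothIn-Joins e-in a-joins))

      inside? = λ (e : Arc) → (proj₁ e ∈? C) ×-dec (proj₂ e ∈? C)
      not-a? = λ (e : Arc) → ¬? (e ≟ₐ a)

      ant-items : concatMap (antItems k C y) (arcsIn C) ≡ concatMap (antItems (suc k) N y) (E ∖ a)
      ant-items = concatMap-filter-cong inside? not-a? E same extra
        where
        same : ∀ {e} → e ∈ E → BothIn C e → e ≢ a × antItems k C y e ≡ antItems (suc k) N y e
        same {w , x} e∈ e-in = not-a e-in , items
          where
          items : antItems k C y (w , x) ≡ antItems (suc k) N y (w , x)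
          items with x ≟ y
          ... | no  _    = refl
          ... | yes refl = cong (λ T → [ sq T ]) (same-sub e∈ e-in (inj₂ refl))
        extra : ∀ {e} → e ∈ E → e ≢ a → ¬ BothIn C e → antItems (suc k) N y e ≡ []
        extra {w , x} e∈ e≢a e-out with x ≟ y
        ... | no  _    = refl
        ... | yes refl =
          ⊥-elim (e-out (∈-side⁺ (proj₁ (Closed-E e∈)) (Reach-bwd (∈-∖⁺ e∈ e≢a)) , Subtree.root∈ subtree))

      suc-items : concatMap (sucItems k C y) (arcsIn C) ≡ concatMap (sucItems (suc k) N y) (E ∖ a)
      suc-items = concatMap-filter-cong inside? not-a? E same extra
        where
        same : ∀ {e} → e ∈ E → BothIn C e → e ≢ a × sucItems k C y e ≡ sucItems (suc k) N y e
        same {x , w} e∈ e-in = not-a e-in , items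
          where
          items : sucItems k C y (x , w) ≡ sucItems (suc k) N y (x , w)
          items with x ≟ y
          ... | no  _    = refl
          ... | yes refl = cong (λ T → [ sq T ]) (same-sub e∈ e-in (inj₁ refl))
        extra : ∀ {e} → e ∈ E → e ≢ a → ¬ BothIn C e → sucItems (suc k) N y e ≡ []
        extra {x , w} e∈ e≢a e-out with x ≟ y
        ... | no  _    = refl
        ... | yes refl =
          ⊥-elim (e-out (Subtree.root∈ subtree , ∈-side⁺ (proj₂ (Closed-E e∈)) (Reach-fwd (∈-∖⁺ e∈ e≢a))))

    translIn-side′ : translIn (suc k) (side N a y) y ≡ assemble (suc k) N y (E ∖ a)
    translIn-side′ =
      trans (unfold subtree k) (cong₂ _⊢_ (cong (at y Γ ++_) ant-items) (cong (at y Δ ++_) suc-items))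

  translIn-side : ∀ {a y' y} → a ∈ E → Joins a y' y →
                  translIn (length N) (side N a y) y ≡ assemble (length N) N y (E ∖ a)
  translIn-side a∈ a-joins with proj₂ (Joins-nodes a∈ a-joins)
  -- Matching on  y ∈ N  exposes  N  as a cons, so that  length N  is a successor.
  ... | here _  = translIn-side′ a∈ a-joins _ refl
  ... | there _ = translIn-side′ a∈ a-joins _ refl

  translation-unfold : LabelsIn G Γ → LabelsIn G Δ → ∀ {x} → x ∈ N →
                       ⟨ Γ ⊢[ G ] Δ ⟩ x ≡ assemble (length N) N x E
  translation-unfold ΓinG ΔinG {x} x∈ =
    trans (transl-cong {suc (length N)} {N} (sym arcsIn-nodes) (sym (restrict-nodes ΓinG))
                                                                (sym (restrict-nodes ΔinG)))
          (trans (unfold (whole x∈) (length N)) (cong (assemble (length N) N x) arcsIn-nodes))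
    where
    restrict-nodes : ∀ {Θ} → LabelsIn G Θ → restrict N Θ ≡ Θ
    restrict-nodes ΘinG = filter-all _ (All.tabulate (λ { {_ , _} p∈ → ΘinG p∈ }))

  antItems-at : ∀ n K r y → antItems n K r (y , r) ≡ [ sq (translIn n (side K (y , r) y) y) ]
  antItems-at n K r y with r ≟ r
  ... | yes _  = refl
  ... | no r≢r = ⊥-elim (r≢r refl)

  antItems-away : ∀ n K r y x → x ≢ r → antItems n K r (y , x) ≡ []
  antItems-away n K r y x x≢r with x ≟ r
  ... | yes x≡r = ⊥-elim (x≢r x≡r)
  ... | no _    = refl

  sucItems-at : ∀ n K r y → sucItems n K r (r , y) ≡ [ sq (translIn n (side K (r , y) y) y) ]
  sucItems-at n K r y with r ≟ r
  ... | yes _  = refl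
  ... | no r≢r = ⊥-elim (r≢r refl)

  sucItems-away : ∀ n K r y x → x ≢ r → sucItems n K r (x , y) ≡ []
  sucItems-away n K r y x x≢r with x ≟ r
  ... | yes x≡r = ⊥-elim (x≢r x≡r)
  ... | no _    = refl

-- Moving the root along the tree

Equiderivable : Seq → Seq → Set
Equiderivable S T = (N-LBiI S → N-LBiI T) × (N-LBiI T → N-LBiI S)

≡-↭-equiderivable : ∀ {S Γ Γ' Δ Δ'} → S ≡ (Γ ⊢ Δ) → Γ ↭ Γ' → Δ ↭ Δ' → Equiderivable S (Γ' ⊢ Δ')
≡-↭-equiderivable refl p q = exchange p q , exchange (↭-sym p) (↭-sym q)

module _ (G : LabelTree) (Γ Δ : LFms) (ΓinG : LabelsIn G Γ) (ΔinG : LabelsIn G Δ) where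
  open Translation G Γ Δ

  module _ {u v} (uv∈ : (u , v) ∈ E) where
    private
      L = length N
      rest = E ∖ (u , v)
      P  = at u Γ ++ concatMap (antItems L N u) rest
      Q  = at u Δ ++ concatMap (sucItems L N u) rest
      P' = at v Γ ++ concatMap (antItems L N v) rest
      Q' = at v Δ ++ concatMap (sucItems L N v) rest

      u≢v = Joins-≢ uv∈ (inj₁ refl)

      pick : ∀ (f : Arc → List Item) {items} → f (u , v) ≡ items →
             concatMap f E ↭ items ++ concatMap f rest
      pick f refl = concatMap-↭-pick _≟ₐ_ f (arcs-uniq G) uv∈

      attached : ∀ {y' y} → Joins (u , v) y' y →
                 [ sq (translIn L (side N (u , v) y) y) ] ≡ [ sq (assemble L N y rest) ]
      attached j = cong (λ T → [ sq T ]) (translIn-side uv∈ j)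

    at-source : Equiderivable (⟨ Γ ⊢[ G ] Δ ⟩ u) (P ⊢ sq (P' ⊢ Q') ∷ Q)
    at-source = ≡-↭-equiderivable (translation-unfold ΓinG ΔinG (proj₁ (Closed-E uv∈)))
      (↭.++⁺ˡ (at u Γ) (pick (antItems L N u) (antItems-away L N u u v (λ v≡u → u≢v (sym v≡u)))))
      (↭.trans (↭.++⁺ˡ (at u Δ)
                 (pick (sucItems L N u) (trans (sucItems-at L N u v) (attached (inj₁ refl)))))
               (↭.shift _ (at u Δ) _))

    at-target : Equiderivable (⟨ Γ ⊢[ G ] Δ ⟩ v) (sq (P ⊢ Q) ∷ P' ⊢ Q')
    at-target = ≡-↭-equiderivable (translation-unfold ΓinG ΔinG (proj₂ (Closed-E uv∈)))
      (↭.trans (↭.++⁺ˡ (at v Γ)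
                 (pick (antItems L N v) (trans (antItems-at L N v u) (attached (inj₂ refl)))))
               (↭.shift _ (at v Γ) _))
      (↭.++⁺ˡ (at v Δ) (pick (sucItems L N v) (sucItems-away L N v v u u≢v)))

    along-arc : Equiderivable (⟨ Γ ⊢[ G ] Δ ⟩ u) (⟨ Γ ⊢[ G ] Δ ⟩ v)
    along-arc = (λ d → proj₂ at-target (reroot (proj₁ at-source d)))
              , (λ d → proj₂ at-source (reroot⁻¹ (proj₁ at-target d)))

  along-walk : ∀ {z ws x} → Walk E z ws x → N-LBiI (⟨ Γ ⊢[ G ] Δ ⟩ z) → N-LBiI (⟨ Γ ⊢[ G ] Δ ⟩ x)
  along-walk stop          d = d
  along-walk (fwd∷ e∈ walk) d = along-walk walk (proj₁ (along-arc e∈) d)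
  along-walk (bwd∷ e∈ walk) d = along-walk walk (proj₂ (along-arc e∈) d)

mainTheorem2 : (G : LabelTree) (Γ Δ : LFms) → LabelsIn G Γ → LabelsIn G Δ →
               (z x : ℕ) → z ∈ nodes G → x ∈ nodes G →
               N-LBiI (⟨ Γ ⊢[ G ] Δ ⟩ z) → N-LBiI (⟨ Γ ⊢[ G ] Δ ⟩ x)
mainTheorem2 G Γ Δ ΓinG ΔinG z x z∈ x∈ =
  along-walk G Γ Δ ΓinG ΔinG (proj₁ (proj₁ (proj₂ (unique-path G z x z∈ x∈))))
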